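{- Let $G$ be a graph and $k,d$ positive integers. If $\mathcal{F}$ is a family of distinct induced odd cycles of $G$, each of length at most $d$, with $|\mathcal{F}|>d\cdot d!\cdot(k-1)^{d}$, then $G$ has a minimal oct of size at least $k$.
   Context: All graphs are finite, simple and undirected. An oct of $G$ is a set $Z\subseteq V(G)$ with $G-Z$ bipartite; it is minimal if no proper subset is an oct. An induced odd cycle is an odd-length cycle whose vertex set induces exactly that cycle. -}

module Defs where

open import Data.Nat using (ℕ; suc; _+_; _*_; _%_; _≤_)
open import Data.Fin using (Fin; toℕ)
open import Data.Fin.Subset using (Subset; _∈_; _∉_; _⊂_; ∣_∣)
open import Data.Bool using (Bool; true; false)
open import Data.Product using (Σ; ∃; _×_)
open import Function.Definitions using (Injective)
open import Relation.Binary.PropositionalEquality using (_≡_; _≢_)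
open import Relation.Nullary using (¬_)
open import Function.Bundles using (_⇔_)

record Graph (n : ℕ) : Set where
  field
    adj   : Fin n → Fin n → Bool
    sym   : ∀ u v → adj u v ≡ adj v u
    irref : ∀ v → adj v v ≡ false

open Graph public

Adj : ∀ {n} → Graph n → Fin n → Fin n → Set
Adj G u v = adj G u v ≡ true

BipartiteMinus : ∀ {n} → Graph n → Subset n → Set
BipartiteMinus {n} G Z =
  Σ (Fin n → Bool) λ c → ∀ u v → u ∉ Z → v ∉ Z → Adj G u v → c u ≢ c v

IsOCT : ∀ {n} → Graph n → Subset n → Set
IsOCT G Z = BipartiteMinus G Z

IsMinimalOCT : ∀ {n} → Graph n → Subset n → Set
IsMinimalOCT G Z = IsOCT G Z × (∀ Z′ → Z′ ⊂ Z → ¬ IsOCT G Z′)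

CycAdj : ∀ m → Fin (suc m) → Fin (suc m) → Set
CycAdj m i j = (toℕ j ≡ (toℕ i + 1) % suc m) ⊎' (toℕ i ≡ (toℕ j + 1) % suc m)
  where
  open import Data.Sum using () renaming (_⊎_ to _⊎'_)

-- S is the vertex set of an induced odd cycle of G: there is an odd
-- ℓ = 2m+3 ≥ 3 and a cyclic enumeration v : Fin ℓ → Fin n, injective,
-- with image exactly S, such that two vertices of S are adjacent in G
-- iff they are consecutive in the cyclic order (so G[S] is exactly the
-- cycle). An induced cycle is determined by its vertex set.
IsInducedOddCycle : ∀ {n} → Graph n → Subset n → Set
IsInducedOddCycle {n} G S =
  Σ ℕ λ m → Σ (Fin (suc (suc (suc (m + m)))) → Fin n) λ v →
    Injective _≡_ _≡_ v
    × (∀ x → (x ∈ S) ⇔ (∃ λ i → v i ≡ x))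
    × (∀ i j → Adj G (v i) (v j) ⇔ CycAdj (suc (suc (m + m))) i j)

cycleLength : ∀ {n} → Subset n → ℕ
cycleLength S = ∣ S ∣

-- By the Erdős–Rado argument the cycles contain a sunflower with k members: a maximal
-- subfamily with pairwise disjoint petals either has k members, or the at most (k-1)d
-- points of its petals meet every cycle, so one of them lies in so many cycles that it can
-- be moved into the core, and the petal size drops.
-- If Y is the core, G[Y] is a proper induced subgraph of an odd cycle, hence bipartite, so
-- ∁ Y is an oct and contains a minimal oct Z. Every oct meets every odd cycle and Z avoids
-- Y, so Z meets each of the pairwise disjoint petals and |Z| ≥ k.
{-# OPTIONS --safe #-}
module Submission where

open import Defs hiding (sym)
open import Data.Bool using (Bool; true; false; not; _xor_)
import Data.Bool as Bool
open import Data.Bool.Properties using (not-involutive; not-¬; ¬-not; not-distribˡ-xor; T-≡)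
open import Data.Empty using (⊥-elim)
open import Data.Fin using (Fin; zero; suc; toℕ; fromℕ; inject₁)
import Data.Fin as Fin
open import Data.Fin.Properties
  using (toℕ-inject₁; toℕ-fromℕ; toℕ-injective; toℕ<n; toℕ≤pred[n]; any?; all?)
open import Data.Fin.Relation.Unary.Top using (view; ‵fromℕ; ‵inject₁)
open import Data.Fin.Subset
  using (Subset; inside; outside; _∈_; _∉_; _⊆_; _⊂_; _∩_; _∪_; _─_; _-_; ⁅_⁆; ∁; ⊥; ⋃; ∣_∣; Nonempty)
open import Data.Fin.Subset.Properties
  using ( _∈?_; _⊂?_; nonempty?; anySubset?; ⊆-refl; ⊆-antisym; ⊥⊆; ∉⊥; ∣⊥∣≡0
        ; p⊆p∪q; q⊆p∪q; x∈p∪q⁻; x∈p∩q⁺; x∈p∩q⁻; x∈⁅x⁆; x∈⁅y⁆⇒x≡y; x∉p⇒x∈∁p; x∈∁p⇒x∉p; x∉∁p⇒x∈p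
        ; p─q⊆p; ∣p─q∣≤∣p∣; p─q─r≡p─q∪r; x∈p∧x∉q⇒x∈p─q; x∈p∧x≢y⇒x∈p-y; x∈p⇒∣p-x∣<∣p∣)
open import Data.List using (List; []; _∷_; length; map; filter)
open import Data.List.Properties using (length-map; filter-all)
open import Data.List.Membership.Propositional using (find) renaming (_∈_ to _∈ˡ_)
open import Data.List.Membership.Propositional.Properties using (∈-filter⁻; ∈-map⁺)
open import Data.List.Relation.Unary.All as All using (All; []; _∷_)
open import Data.List.Relation.Unary.All.Properties using (¬Any⇒All¬)
import Data.List.Relation.Unary.All.Properties as Allₚ
open import Data.List.Relation.Unary.Any using (Any; here; there)
import Data.List.Relation.Unary.Any as Any
import Data.List.Relation.Unary.Any.Properties as Anyₚ
open import Data.List.Relation.Unary.AllPairs as AllPairs using (AllPairs; []; _∷_)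
open import Data.List.Relation.Unary.Unique.Propositional using (Unique)
import Data.List.Relation.Unary.Unique.Propositional.Properties as Uniqueₚ
open import Data.List.Relation.Binary.Sublist.Propositional
  using ([]; _∷_; _∷ʳ_) renaming (_⊆_ to _⊑_; ⊆-trans to ⊑-trans)
open import Data.List.Relation.Binary.Sublist.Propositional.Properties
  using (filter-⊆; filter⁺; length-mono-≤; All-resp-⊆)
open import Data.Nat
  using (ℕ; zero; suc; _+_; _*_; _∸_; _^_; _!; _%_; _<ᵇ_; _≤_; _<_; z≤n; s≤s; z<s; _≤?_; _<?_)
open import Data.Nat.DivMod using (m<n⇒m%n≡m; n%n≡0)
open import Data.Nat.Induction using (<-wellFounded)
open import Data.Nat.Properties
open import Data.Nat.Tactic.RingSolver using (solve-∀)
open import Data.Product using (Σ; ∃; _×_; _,_; proj₁; proj₂)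
open import Data.Sum using (_⊎_; inj₁; [_,_]′)
import Data.Sum as Sum
open import Data.Vec using ([]; _∷_; here; there; lookup; tabulate)
open import Data.Vec.Properties using (lookup∘tabulate)
open import Function using (_∘_)
open import Function.Bundles using (Equivalence)
open import Function.Definitions using (Injective)
open import Induction.WellFounded using (Acc; acc)
open import Relation.Binary.PropositionalEquality
  using (_≡_; _≢_; refl; sym; trans; cong; cong₂; subst; ≢-sym; module ≡-Reasoning)
open import Relation.Nullary using (¬_; Dec; yes; no; ¬?; _×-dec_; _→-dec_; contradiction)
open import Relation.Nullary.Decidable using (map′; decidable-stable)
open import Relation.Unary using (Decidable)

private variable
  n : ℕ

module _ {A : Set} {P : A → Set} (P? : Decidable P) where

  length≤filter+filter¬ : ∀ xs → length xs ≤ length (filter P? xs) + length (filter (¬? ∘ P?) xs)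
  length≤filter+filter¬ [] = z≤n
  length≤filter+filter¬ (x ∷ xs) with P? x
  ... | yes _ = s≤s (length≤filter+filter¬ xs)
  ... | no _  = ≤-trans (s≤s (length≤filter+filter¬ xs)) (≤-reflexive (sym (+-suc _ _)))

  length≤1+filter : ∀ {xs} (a : A) → Unique xs → (∀ {x} → x ∈ˡ xs → ¬ P x → x ≡ a) →
                    length xs ≤ suc (length (filter P? xs))
  length≤1+filter a [] _ = z≤n
  length≤1+filter {x ∷ xs} a (x∉xs ∷ uxs) onlyA with P? x
  ... | yes _  = s≤s (length≤1+filter a uxs (onlyA ∘ there))
  ... | no ¬Px = s≤s (≤-reflexive (cong length (sym (filter-all P? (All.tabulate Py)))))
    where
    Py : ∀ {y} → y ∈ˡ xs → P y
    Py y∈xs = decidable-stable (P? _) λ ¬Py →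
      All.lookup x∉xs y∈xs (trans (onlyA (here refl) ¬Px) (sym (onlyA (there y∈xs) ¬Py)))

module _ {A : Set} {R : A → A → Set} (R? : ∀ a b → Dec (R a b)) where

  independentDominatingSublist : ∀ xs → All (λ x → R x x) xs →
    ∃ λ ds → ds ⊑ xs × AllPairs (λ a b → ¬ R a b) ds × All (λ x → Any (R x) ds) xs
  independentDominatingSublist [] [] = [] , [] , [] , []
  independentDominatingSublist (x ∷ xs) (Rxx ∷ Rxs) with independentDominatingSublist xs Rxs
  ... | ds , ds⊑xs , independent , dominated with Any.any? (R? x) ds
  ...   | yes x↯ds = ds , x ∷ʳ ds⊑xs , independent , x↯ds ∷ dominated
  ...   | no ¬x↯ds = x ∷ ds , refl ∷ ds⊑xs , ¬Any⇒All¬ ds ¬x↯ds ∷ independent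
                   , here Rxx ∷ All.map there dominated

x∈p─q⇒x∉q : ∀ {x : Fin n} (p q : Subset n) → x ∈ p ─ q → x ∉ q
x∈p─q⇒x∉q (inside ∷ p) (outside ∷ q) here ()
x∈p─q⇒x∉q (_ ∷ p) (_ ∷ q) (there x∈p─q) (there x∈q) = x∈p─q⇒x∉q p q x∈p─q x∈q

∪-lub : ∀ {p q r : Subset n} → p ⊆ r → q ⊆ r → p ∪ q ⊆ r
∪-lub {p = p} {q = q} p⊆r q⊆r x∈p∪q = [ p⊆r , q⊆r ]′ (x∈p∪q⁻ p q x∈p∪q)

⊆⋃ : ∀ {p} {ps : List (Subset n)} → p ∈ˡ ps → p ⊆ ⋃ ps
⊆⋃ {ps = p ∷ ps} (here refl)  = p⊆p∪q (⋃ ps)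
⊆⋃ {ps = p ∷ ps} (there p∈ps) = q⊆p∪q p (⋃ ps) ∘ ⊆⋃ p∈ps

⋃─⊆∁ : ∀ (q : Subset n) ps → ⋃ (map (_─ q) ps) ⊆ ∁ q
⋃─⊆∁ q []       = ⊥⊆
⋃─⊆∁ q (p ∷ ps) = ∪-lub (x∉p⇒x∈∁p ∘ x∈p─q⇒x∉q p q) (⋃─⊆∁ q ps)

∣p∪q∣≤∣p∣+∣q∣ : (p q : Subset n) → ∣ p ∪ q ∣ ≤ ∣ p ∣ + ∣ q ∣
∣p∪q∣≤∣p∣+∣q∣ [] [] = z≤n
∣p∪q∣≤∣p∣+∣q∣ (outside ∷ p) (outside ∷ q) = ∣p∪q∣≤∣p∣+∣q∣ p q
∣p∪q∣≤∣p∣+∣q∣ (outside ∷ p) (inside ∷ q)  =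
  ≤-trans (s≤s (∣p∪q∣≤∣p∣+∣q∣ p q)) (≤-reflexive (sym (+-suc ∣ p ∣ ∣ q ∣)))
∣p∪q∣≤∣p∣+∣q∣ (inside ∷ p) (outside ∷ q)  = s≤s (∣p∪q∣≤∣p∣+∣q∣ p q)
∣p∪q∣≤∣p∣+∣q∣ (inside ∷ p) (inside ∷ q)   =
  s≤s (≤-trans (∣p∪q∣≤∣p∣+∣q∣ p q) (+-monoʳ-≤ ∣ p ∣ (n≤1+n ∣ q ∣)))

∣⋃∣≤length*max : ∀ {s} {ps : List (Subset n)} → All (λ p → ∣ p ∣ ≤ s) ps → ∣ ⋃ ps ∣ ≤ length ps * s
∣⋃∣≤length*max {n = n} []                 = ≤-reflexive (∣⊥∣≡0 n)
∣⋃∣≤length*max {ps = p ∷ ps} (p≤s ∷ ps≤s) =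
  ≤-trans (∣p∪q∣≤∣p∣+∣q∣ p (⋃ ps)) (+-mono-≤ p≤s (∣⋃∣≤length*max ps≤s))

∣p─q∪⁅x⁆∣<∣p─q∣ : ∀ {x : Fin n} {p q} → x ∈ p → x ∉ q → ∣ p ─ (q ∪ ⁅ x ⁆) ∣ < ∣ p ─ q ∣
∣p─q∪⁅x⁆∣<∣p─q∣ {x = x} {p} {q} x∈p x∉q =
  subst (_< ∣ p ─ q ∣) (cong ∣_∣ (p─q─r≡p─q∪r p q ⁅ x ⁆)) (x∈p⇒∣p-x∣<∣p∣ (x∈p∧x∉q⇒x∈p─q x∈p x∉q))

⊆∧⊄⇒≡ : ∀ {p q : Subset n} → p ⊆ q → ¬ (p ⊂ q) → q ≡ p
⊆∧⊄⇒≡ {p = p} {q} p⊆q p⊄q = ⊆-antisym q⊆p p⊆q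
  where
  q⊆p : q ⊆ p
  q⊆p {x} x∈q with x ∈? p
  ... | yes x∈p = x∈p
  ... | no x∉p  = ⊥-elim (p⊄q (p⊆q , x , x∈q , x∉p))

⊥⊂ : ∀ {p : Subset n} → Nonempty p → ⊥ ⊂ p
⊥⊂ (x , x∈p) = ⊥⊆ , x , x∈p , ∉⊥

count : Fin n → List (Subset n) → ℕ
count x F = length (filter (x ∈?_) F)

popularPoint : ∀ M (U : Subset n) F → All (λ C → Nonempty (C ∩ U)) F → ∣ U ∣ * M < length F →
               ∃ λ x → x ∈ U × M < count x F
popularPoint M U F = go U F (<-wellFounded ∣ U ∣)
  where
  go : ∀ U F → Acc _<_ ∣ U ∣ → All (λ C → Nonempty (C ∩ U)) F → ∣ U ∣ * M < length F →
       ∃ λ x → x ∈ U × M < count x F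
  go U [] _ _ ()
  go U F@(C ∷ _) (acc rec) meets@((x , x∈C∩U) ∷ _) big
    with M <? count x F | proj₂ (x∈p∩q⁻ C U x∈C∩U)
  ... | yes popular | x∈U = x , x∈U , popular
  ... | no ¬popular | x∈U =
    let y , y∈U-x , popular = go (U - x) Fₓ̄ (rec (x∈p⇒∣p-x∣<∣p∣ x∈U)) meets′ big′
    in y , p─q⊆p U ⁅ x ⁆ y∈U-x , ≤-trans popular (length-mono-≤ (Fₓ̄⊑F y))
    where
    Fₓ̄ = filter (¬? ∘ (x ∈?_)) F
    Fₓ̄⊑F : ∀ y → filter (y ∈?_) Fₓ̄ ⊑ filter (y ∈?_) F
    Fₓ̄⊑F y = filter⁺ (y ∈?_) (y ∈?_) (λ { refl y∈D → y∈D }) (filter-⊆ (¬? ∘ (x ∈?_)) F)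
    meets′ : All (λ D → Nonempty (D ∩ (U - x))) Fₓ̄
    meets′ = All.tabulate λ {D} D∈Fₓ̄ →
      let D∈F , x∉D = ∈-filter⁻ (¬? ∘ (x ∈?_)) D∈Fₓ̄
          z , z∈D∩U = All.lookup meets D∈F
          z∈D , z∈U = x∈p∩q⁻ D U z∈D∩U
      in z , x∈p∩q⁺ (z∈D , x∈p∧x≢y⇒x∈p-y z∈U λ z≡x → x∉D (subst (_∈ D) z≡x z∈D))
    big′ : ∣ U - x ∣ * M < length Fₓ̄
    big′ = +-cancelˡ-< M _ _ (begin-strict
      M + ∣ U - x ∣ * M        ≤⟨ *-monoˡ-≤ M (x∈p⇒∣p-x∣<∣p∣ x∈U) ⟩
      ∣ U ∣ * M                <⟨ big ⟩
      length F                 ≤⟨ length≤filter+filter¬ (x ∈?_) F ⟩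
      count x F + length Fₓ̄   ≤⟨ +-monoˡ-≤ (length Fₓ̄) (≮⇒≥ ¬popular) ⟩
      M + length Fₓ̄           ∎)
      where open ≤-Reasoning

record SunflowerIn (F : List (Subset n)) (p : ℕ) : Set where
  field
    core      : Subset n
    members   : List (Subset n)
    members⊑F : members ⊑ F
    core⊂     : All (core ⊂_) members
    disjoint  : AllPairs (λ A B → A ∩ B ⊆ core) members
    large     : p ≤ length members

sunflowerIn-⊑ : ∀ {F′ F : List (Subset n)} {p} → F′ ⊑ F → SunflowerIn F′ p → SunflowerIn F p
sunflowerIn-⊑ F′⊑F S = record
  { SunflowerIn S hiding (members⊑F)
  ; members⊑F = ⊑-trans (SunflowerIn.members⊑F S) F′⊑F
  }

-- Equivalently, the petals A ─ Y and B ─ Y meet.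
Conflict : Subset n → Subset n → Subset n → Set
Conflict Y A B = Nonempty (A ∩ (B ─ Y))

conflict? : (Y A B : Subset n) → Dec (Conflict Y A B)
conflict? Y A B = nonempty? (A ∩ (B ─ Y))

⊂⇒conflict : ∀ {Y C : Subset n} → Y ⊂ C → Conflict Y C C
⊂⇒conflict (_ , x , x∈C , x∉Y) = x , x∈p∩q⁺ (x∈C , x∈p∧x∉q⇒x∈p─q x∈C x∉Y)

¬conflict⇒∩⊆ : ∀ {Y A B : Subset n} → ¬ Conflict Y A B → A ∩ B ⊆ Y
¬conflict⇒∩⊆ {Y = Y} {A} {B} noConflict {x} x∈A∩B with x ∈? Y
... | yes x∈Y = x∈Y
... | no x∉Y  = ⊥-elim (noConflict (x , x∈p∩q⁺ (x∈A , x∈p∧x∉q⇒x∈p─q x∈B x∉Y)))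
  where
  x∈A = proj₁ (x∈p∩q⁻ A B x∈A∩B)
  x∈B = proj₂ (x∈p∩q⁻ A B x∈A∩B)

conflicts⇒meets⋃ : ∀ {Y C : Subset n} {D} → Any (Conflict Y C) D → Nonempty (C ∩ ⋃ (map (_─ Y) D))
conflicts⇒meets⋃ {Y = Y} {C} C↯D =
  let B , B∈D , x , x∈C∩B─Y = find C↯D
      x∈C , x∈B─Y = x∈p∩q⁻ C (B ─ Y) x∈C∩B─Y
  in x , x∈p∩q⁺ (x∈C , ⊆⋃ (∈-map⁺ (_─ Y) B∈D) x∈B─Y)

-- Among distinct supersets of Y containing x, only Y ∪ ⁅ x ⁆ itself is not a strict superset of it.
count≤1+#⊃ : ∀ {x : Fin n} {Y} {F} → Unique F → All (Y ⊆_) F →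
             count x F ≤ suc (length (filter (Y ∪ ⁅ x ⁆ ⊂?_) F))
count≤1+#⊃ {x = x} {Y} {F} uF Y⊆F = begin
  count x F                                 ≤⟨ length≤1+filter (Y′ ⊂?_) Y′ (Uniqueₚ.filter⁺ (x ∈?_) uF) onlyY′ ⟩
  suc (length (filter (Y′ ⊂?_) Fₓ))         ≤⟨ s≤s (length-mono-≤ Fₓ′⊑F′) ⟩
  suc (length (filter (Y′ ⊂?_) F))          ∎
  where
  open ≤-Reasoning
  Y′ = Y ∪ ⁅ x ⁆
  Fₓ = filter (x ∈?_) F
  Fₓ′⊑F′ = filter⁺ (Y′ ⊂?_) (Y′ ⊂?_) (λ { refl Y′⊂C → Y′⊂C }) (filter-⊆ (x ∈?_) F)
  onlyY′ : ∀ {C} → C ∈ˡ Fₓ → ¬ (Y′ ⊂ C) → C ≡ Y′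
  onlyY′ C∈Fₓ = let C∈F , x∈C = ∈-filter⁻ (x ∈?_) C∈Fₓ in
    ⊆∧⊄⇒≡ (∪-lub (All.lookup Y⊆F C∈F) λ y∈⁅x⁆ → subst (_∈ _) (sym (x∈⁅y⁆⇒x≡y x y∈⁅x⁆)) x∈C)

enlargeCore : ∀ {x : Fin n} {Y s} {F} → x ∉ Y → All (λ C → Y ⊂ C × ∣ C ─ Y ∣ ≤ suc s) F →
              All (λ C → Y ∪ ⁅ x ⁆ ⊂ C × ∣ C ─ (Y ∪ ⁅ x ⁆) ∣ ≤ s) (filter (Y ∪ ⁅ x ⁆ ⊂?_) F)
enlargeCore {x = x} {Y} x∉Y bounded = All.tabulate λ C∈F′ →
  let C∈F , Y∪x⊂C = ∈-filter⁻ (Y ∪ ⁅ x ⁆ ⊂?_) C∈F′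
      x∈C = proj₁ Y∪x⊂C (q⊆p∪q Y ⁅ x ⁆ (x∈⁅x⁆ x))
  in Y∪x⊂C , ≤-pred (<-≤-trans (∣p─q∪⁅x⁆∣<∣p─q∣ x∈C x∉Y) (proj₂ (All.lookup bounded C∈F)))

-- The bound f(s) = s ∙ s! ∙ Kˢ is chosen for this step: the at most K(s+1) points of the
-- petals, each in at most f(s)+1 members, cover the family.
erdősRado-step : ∀ K s → K * suc s * suc (s * s ! * K ^ s) ≤ suc s * suc s ! * K ^ suc s
erdősRado-step zero      s = z≤n
erdősRado-step K@(suc _) s = begin
  K * suc s * suc (s * s ! * K ^ s)             ≤⟨ *-monoʳ-≤ (K * suc s) (+-monoˡ-≤ (s * s ! * K ^ s) 1≤s!Kˢ) ⟩
  K * suc s * (s ! * K ^ s + s * s ! * K ^ s)   ≡⟨ expand K s (s !) (K ^ s) ⟩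
  suc s * suc s ! * K ^ suc s                   ∎
  where
  open ≤-Reasoning
  1≤s!Kˢ : 1 ≤ s ! * K ^ s
  1≤s!Kˢ = *-mono-≤ (1≤n! s) (m^n>0 K s)
  expand : ∀ K s f p → K * (1 + s) * (f * p + s * f * p) ≡ (1 + s) * ((1 + s) * f) * (K * p)
  expand = solve-∀

sunflower : ∀ K s (Y : Subset n) F → Unique F → All (λ C → Y ⊂ C × ∣ C ─ Y ∣ ≤ s) F →
            s * s ! * K ^ s < length F → SunflowerIn F (suc K)
sunflower _ zero _ [] _ _ ()
sunflower _ zero _ (C ∷ _) _ (((_ , x , x∈C , x∉Y) , ∣C─Y∣≤0) ∷ _) _ =
  contradiction (<-≤-trans (x∈p⇒∣p-x∣<∣p∣ (x∈p∧x∉q⇒x∈p─q x∈C x∉Y)) ∣C─Y∣≤0) n≮0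
sunflower K (suc s) Y F uF bounded big
  with independentDominatingSublist (conflict? Y) F (All.map (⊂⇒conflict ∘ proj₁) bounded)
... | D , D⊑F , independent , dominated with suc K ≤? length D
...   | yes large = record
  { core      = Y
  ; members   = D
  ; members⊑F = D⊑F
  ; core⊂     = All-resp-⊆ D⊑F (All.map proj₁ bounded)
  ; disjoint  = AllPairs.map ¬conflict⇒∩⊆ independent
  ; large     = large
  }
...   | no small =
  let x , x∈U , popular = popularPoint M U F (All.map conflicts⇒meets⋃ dominated) U-small
      x∉Y = x∈∁p⇒x∉p (⋃─⊆∁ Y D x∈U)
      F′ = filter (Y ∪ ⁅ x ⁆ ⊂?_) F
      F′-big : s * s ! * K ^ s < length F′
      F′-big = ≤-pred (<-≤-trans popular (count≤1+#⊃ uF (All.map (proj₁ ∘ proj₁) bounded)))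
  in sunflowerIn-⊑ (filter-⊆ (Y ∪ ⁅ x ⁆ ⊂?_) F)
       (sunflower K s (Y ∪ ⁅ x ⁆) F′ (Uniqueₚ.filter⁺ _ uF) (enlargeCore x∉Y bounded) F′-big)
  where
  M = suc (s * s ! * K ^ s)
  U = ⋃ (map (_─ Y) D)
  ∣U∣≤K*[1+s] : ∣ U ∣ ≤ K * suc s
  ∣U∣≤K*[1+s] = ≤-trans (∣⋃∣≤length*max (Allₚ.map⁺ (All-resp-⊆ D⊑F (All.map proj₂ bounded))))
                        (*-monoˡ-≤ (suc s) (≤-trans (≤-reflexive (length-map (_─ Y) D)) (≤-pred (≰⇒> small))))
  U-small : ∣ U ∣ * M < length F
  U-small = ≤-<-trans (≤-trans (*-monoˡ-≤ M ∣U∣≤K*[1+s]) (erdősRado-step K s)) big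

length≤∣transversal∣ : ∀ {Y Z : Subset n} L → Z ⊆ ∁ Y → AllPairs (λ A B → A ∩ B ⊆ Y) L →
                       All (λ C → Nonempty (C ∩ Z)) L → length L ≤ ∣ Z ∣
length≤∣transversal∣ [] _ _ _ = z≤n
length≤∣transversal∣ {Y = Y} {Z} (C ∷ L) Z⊆∁Y (C∩L⊆Y ∷ disjoint) ((x , x∈C∩Z) ∷ meets) =
  ≤-<-trans (length≤∣transversal∣ L (Z⊆∁Y ∘ p─q⊆p Z ⁅ x ⁆) disjoint (All.zipWith avoid (C∩L⊆Y , meets)))
            (x∈p⇒∣p-x∣<∣p∣ x∈Z)
  where
  x∈C = proj₁ (x∈p∩q⁻ C Z x∈C∩Z)
  x∈Z = proj₂ (x∈p∩q⁻ C Z x∈C∩Z)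
  avoid : ∀ {B} → (C ∩ B ⊆ Y) × Nonempty (B ∩ Z) → Nonempty (B ∩ (Z - x))
  avoid {B} (C∩B⊆Y , y , y∈B∩Z) =
    let y∈B , y∈Z = x∈p∩q⁻ B Z y∈B∩Z in
    y , x∈p∩q⁺ (y∈B , x∈p∧x≢y⇒x∈p-y y∈Z λ { refl → x∈∁p⇒x∉p (Z⊆∁Y x∈Z) (C∩B⊆Y (x∈p∩q⁺ (x∈C , y∈B))) })

parity : ℕ → Bool
parity zero    = false
parity (suc k) = not (parity k)

parity-double : ∀ m → parity (m + m) ≡ false
parity-double zero    = refl
parity-double (suc m) = trans (cong (not ∘ parity) (+-suc m m)) (trans (not-involutive _) (parity-double m))

-- The successor relation underlying CycAdj, without modular arithmetic.
data CycSucc {L : ℕ} : Fin (suc L) → Fin (suc L) → Set where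
  step : (a : Fin L) → CycSucc (inject₁ a) (suc a)
  wrap : CycSucc (fromℕ L) zero

cycSucc⇒≡suc% : ∀ {L} {i j : Fin (suc L)} → CycSucc i j → toℕ j ≡ (toℕ i + 1) % suc L
cycSucc⇒≡suc% {L} (step a) = sym (begin
  (toℕ (inject₁ a) + 1) % suc L  ≡⟨ cong (λ k → (k + 1) % suc L) (toℕ-inject₁ a) ⟩
  (toℕ a + 1) % suc L            ≡⟨ cong (_% suc L) (+-comm (toℕ a) 1) ⟩
  suc (toℕ a) % suc L            ≡⟨ m<n⇒m%n≡m (s≤s (toℕ<n a)) ⟩
  suc (toℕ a)                    ∎)
  where open ≡-Reasoning
cycSucc⇒≡suc% {L} wrap = sym (begin
  (toℕ (fromℕ L) + 1) % suc L  ≡⟨ cong (λ k → (k + 1) % suc L) (toℕ-fromℕ L) ⟩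
  (L + 1) % suc L              ≡⟨ cong (_% suc L) (+-comm L 1) ⟩
  suc L % suc L                ≡⟨ n%n≡0 (suc L) ⟩
  0                            ∎)
  where open ≡-Reasoning

≡suc%⇒cycSucc : ∀ {L} (i j : Fin (suc L)) → toℕ j ≡ (toℕ i + 1) % suc L → CycSucc i j
≡suc%⇒cycSucc {L} i j j≡i+1 with view i
... | ‵fromℕ     = subst (CycSucc _) (toℕ-injective (trans (cycSucc⇒≡suc% (wrap {L})) (sym j≡i+1))) wrap
... | ‵inject₁ a = subst (CycSucc _) (toℕ-injective (trans (cycSucc⇒≡suc% (step {L} a)) (sym j≡i+1))) (step a)

cycAdj⇒cycSucc : ∀ {L} {i j : Fin (suc L)} → CycAdj L i j → CycSucc i j ⊎ CycSucc j i
cycAdj⇒cycSucc = Sum.map (≡suc%⇒cycSucc _ _) (≡suc%⇒cycSucc _ _)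

alternating-end : ∀ L (b : Fin (suc L) → Bool) → (∀ a → b (inject₁ a) ≢ b (suc a)) →
                  b (fromℕ L) ≡ parity L xor b zero
alternating-end zero    b _   = refl
alternating-end (suc L) b alt = begin
  b (suc (fromℕ L))              ≡⟨ ¬-not (≢-sym (alt (fromℕ L))) ⟩
  not (b (inject₁ (fromℕ L)))    ≡⟨ cong not (alternating-end L (b ∘ inject₁) (alt ∘ inject₁)) ⟩
  not (parity L xor b zero)      ≡⟨ not-distribˡ-xor (parity L) (b zero) ⟩
  parity (suc L) xor b zero      ∎
  where open ≡-Reasoning

oddCycle-not-2-colourable : ∀ m (b : Fin (suc (suc (suc (m + m)))) → Bool) →
                            ¬ (∀ {i j} → CycSucc i j → b i ≢ b j)
oddCycle-not-2-colourable m b proper = proper wrap (begin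
  b (fromℕ L)          ≡⟨ alternating-end L b (proper ∘ step) ⟩
  parity L xor b zero  ≡⟨ cong (_xor b zero) (trans (not-involutive _) (parity-double m)) ⟩
  b zero               ∎)
  where
  open ≡-Reasoning
  L = suc (suc (m + m))

<ᵇ-suc : ∀ {m n} → m ≢ n → (m <ᵇ suc n) ≡ (m <ᵇ n)
<ᵇ-suc {zero}  {zero}  0≢0 = contradiction refl 0≢0
<ᵇ-suc {zero}  {suc n} _   = refl
<ᵇ-suc {suc m} {zero}  _   = refl
<ᵇ-suc {suc m} {suc n} m≢n = <ᵇ-suc (m≢n ∘ cong suc)

-- Parity colouring, flipped after the removed position j: on the remaining path
-- j+1, …, L, 0, …, j-1 the colours alternate, also across the edge L–0 since L is even.
pathColouring : ∀ {L} → Fin (suc L) → Fin (suc L) → Bool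
pathColouring j i = parity (toℕ i) xor (toℕ j <ᵇ toℕ i)

pathColouring-proper : ∀ {L} → parity L ≡ false → (j : Fin (suc L)) → ∀ {i i′} →
                       i ≢ j → i′ ≢ j → CycSucc i i′ → pathColouring j i ≢ pathColouring j i′
pathColouring-proper _ j {i′ = suc a} a≢j _ (step a) same = not-¬ refl (begin
  pathColouring j (inject₁ a)        ≡⟨ same ⟩
  not (parity A) xor (J <ᵇ suc A)    ≡⟨ cong (not (parity A) xor_) (<ᵇ-suc J≢A) ⟩
  not (parity A) xor (J <ᵇ A)        ≡⟨ not-distribˡ-xor (parity A) (J <ᵇ A) ⟨
  not (parity A xor (J <ᵇ A))        ≡⟨ cong (λ k → not (parity k xor (J <ᵇ k))) (toℕ-inject₁ a) ⟨
  not (pathColouring j (inject₁ a))  ∎)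
  where
  open ≡-Reasoning
  J = toℕ j
  A = toℕ a
  J≢A : J ≢ A
  J≢A J≡A = a≢j (toℕ-injective (trans (toℕ-inject₁ a) (sym J≡A)))
pathColouring-proper {L} even j L≢j _ wrap same = contradiction (trans (sym L-colour≡true) same) λ ()
  where
  open ≡-Reasoning
  J<L : toℕ j < L
  J<L = ≤∧≢⇒< (toℕ≤pred[n] j) λ J≡L → L≢j (toℕ-injective (trans (toℕ-fromℕ L) (sym J≡L)))
  L-colour≡true : pathColouring j (fromℕ L) ≡ true
  L-colour≡true = begin
    parity (toℕ (fromℕ L)) xor (toℕ j <ᵇ toℕ (fromℕ L))  ≡⟨ cong (λ k → parity k xor (toℕ j <ᵇ k)) (toℕ-fromℕ L) ⟩
    parity L xor (toℕ j <ᵇ L)                            ≡⟨ cong₂ _xor_ even (Equivalence.to T-≡ (<⇒<ᵇ J<L)) ⟩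
    true                                                 ∎

extendAlongInjection : ∀ {ℓ} (v : Fin ℓ → Fin n) → Injective _≡_ _≡_ v → (b : Fin ℓ → Bool) →
                       ∃ λ c → ∀ i → c (v i) ≡ b i
extendAlongInjection {n = n} v v-inj b = c , c∘v≡b
  where
  c : Fin n → Bool
  c x with any? (λ i → v i Fin.≟ x)
  ... | yes (i , _) = b i
  ... | no _        = false
  c∘v≡b : ∀ i → c (v i) ≡ b i
  c∘v≡b i with any? (λ i′ → v i′ Fin.≟ v i)
  ... | yes (i′ , vi′≡vi) = cong b (v-inj vi′≡vi)
  ... | no ¬∃             = contradiction (i , refl) ¬∃

module _ (G : Graph n) where

  ProperOff : Subset n → (Fin n → Bool) → Set
  ProperOff Z c = ∀ u v → u ∉ Z → v ∉ Z → Adj G u v → c u ≢ c v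

  properOff? : ∀ Z c → Dec (ProperOff Z c)
  properOff? Z c = all? λ u → all? λ v →
    ¬? (u ∈? Z) →-dec ¬? (v ∈? Z) →-dec (adj G u v Bool.≟ true) →-dec ¬? (c u Bool.≟ c v)

  -- A colouring is encoded as the subset of vertices coloured true, so that anySubset? applies.
  isOCT? : ∀ Z → Dec (IsOCT G Z)
  isOCT? Z = map′ (λ (S , proper) → lookup S , proper) fromColouring (anySubset? (properOff? Z ∘ lookup))
    where
    fromColouring : IsOCT G Z → ∃ (ProperOff Z ∘ lookup)
    fromColouring (c , proper) = tabulate c , λ u v u∉Z v∉Z uv same →
      proper u v u∉Z v∉Z uv (trans (sym (lookup∘tabulate c u)) (trans same (lookup∘tabulate c v)))

  isOCT-⊆ : ∀ {Z Z′} → Z ⊆ Z′ → IsOCT G Z → IsOCT G Z′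
  isOCT-⊆ Z⊆Z′ (c , proper) = c , λ u v u∉Z′ v∉Z′ → proper u v (u∉Z′ ∘ Z⊆Z′) (v∉Z′ ∘ Z⊆Z′)

  -- Since octs are closed upwards, W is minimal as soon as no W - z is an oct.
  minimalOCT-⊆ : ∀ {W} → IsOCT G W → ∃ λ Z → Z ⊆ W × IsMinimalOCT G Z
  minimalOCT-⊆ {W} = go W (<-wellFounded ∣ W ∣)
    where
    go : ∀ W → Acc _<_ ∣ W ∣ → IsOCT G W → ∃ λ Z → Z ⊆ W × IsMinimalOCT G Z
    go W (acc rec) octW with any? (λ z → z ∈? W ×-dec isOCT? (W - z))
    ... | yes (z , z∈W , octW-z) =
      let Z , Z⊆W-z , minimal = go (W - z) (rec (x∈p⇒∣p-x∣<∣p∣ z∈W)) octW-z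
      in Z , (λ x∈Z → p─q⊆p W ⁅ z ⁆ (Z⊆W-z x∈Z)) , minimal
    ... | no ¬removable = W , ⊆-refl , octW , λ where
      Z′ (Z′⊆W , z , z∈W , z∉Z′) octZ′ → ¬removable (z , z∈W , isOCT-⊆ (λ y∈Z′ →
        x∈p∧x≢y⇒x∈p-y (Z′⊆W y∈Z′) λ { refl → z∉Z′ y∈Z′ }) octZ′)

  oddCycle-nonempty : ∀ {S} → IsInducedOddCycle G S → Nonempty S
  oddCycle-nonempty (_ , v , _ , v-onto , _) = v zero , Equivalence.from (v-onto (v zero)) (zero , refl)

  oddCycle-meets-OCT : ∀ {S Z} → IsInducedOddCycle G S → IsOCT G Z → Nonempty (S ∩ Z)
  oddCycle-meets-OCT {Z = Z} (m , v , _ , v-onto , v-adj) (c , proper) with any? (λ i → v i ∈? Z)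
  ... | yes (i , vi∈Z) = v i , x∈p∩q⁺ (Equivalence.from (v-onto (v i)) (i , refl) , vi∈Z)
  ... | no avoids      = ⊥-elim (oddCycle-not-2-colourable m (c ∘ v) λ {i} {j} i→j →
    proper (v i) (v j) (avoids ∘ (i ,_)) (avoids ∘ (j ,_))
           (Equivalence.from (v-adj i j) (inj₁ (cycSucc⇒≡suc% i→j))))

  ⊂oddCycle⇒∁isOCT : ∀ {S Y} → IsInducedOddCycle G S → Y ⊂ S → IsOCT G (∁ Y)
  ⊂oddCycle⇒∁isOCT {Y = Y} (m , v , v-inj , v-onto , v-adj) (Y⊆S , x , x∈S , x∉Y)
    with Equivalence.to (v-onto x) x∈S
  ... | j , refl = c , proper
    where
    b = pathColouring j
    c = proj₁ (extendAlongInjection v v-inj b)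
    c∘v≡b = proj₂ (extendAlongInjection v v-inj b)
    b-proper : ∀ {a a′} → a ≢ j → a′ ≢ j → CycSucc a a′ → b a ≢ b a′
    b-proper = pathColouring-proper (trans (not-involutive _) (parity-double m)) j
    position : ∀ {u} → u ∉ ∁ Y → ∃ λ a → v a ≡ u × a ≢ j
    position u∉∁Y with Equivalence.to (v-onto _) (Y⊆S (x∉∁p⇒x∈p u∉∁Y))
    ... | a , refl = a , refl , λ { refl → x∉Y (x∉∁p⇒x∈p u∉∁Y) }
    proper : ProperOff (∁ Y) c
    proper u w u∉∁Y w∉∁Y uw with position u∉∁Y | position w∉∁Y
    ... | a , refl , a≢j | a′ , refl , a′≢j = λ same →
      [ (λ a→a′ → b-proper a≢j a′≢j a→a′) , (λ a′→a → b-proper a′≢j a≢j a′→a ∘ sym) ]′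
        (cycAdj⇒cycSucc (Equivalence.to (v-adj a a′) uw))
        (trans (sym (c∘v≡b a)) (trans same (c∘v≡b a′)))

  sunflowerCore-∁isOCT : ∀ {Y} {L : List (Subset n)} → All (IsInducedOddCycle G) L → All (Y ⊂_) L →
                         0 < length L → IsOCT G (∁ Y)
  sunflowerCore-∁isOCT []          []          ()
  sunflowerCore-∁isOCT (cycle ∷ _) (Y⊂C ∷ _) _ = ⊂oddCycle⇒∁isOCT cycle Y⊂C

lemma17 : ∀ {n} (G : Graph n) (k d : ℕ) → 1 ≤ k → 1 ≤ d →
    (F : List (Subset n)) → Unique F →
    All (IsInducedOddCycle G) F → All (λ S → cycleLength S ≤ d) F →
    d * (d !) * ((k ∸ 1) ^ d) < length F →
    Σ (Subset n) λ Z → IsMinimalOCT G Z × (k ≤ ∣ Z ∣)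
lemma17 G k d _ _ F uF cycles lengths big =
  let open SunflowerIn (sunflower (k ∸ 1) d ⊥ F uF (All.zipWith ⊥-bounded (cycles , lengths)) big)
      cyclesₘ = All-resp-⊆ members⊑F cycles
      Z , Z⊆∁core , minimal = minimalOCT-⊆ G (sunflowerCore-∁isOCT G cyclesₘ core⊂ (<-≤-trans z<s large))
      Z-meets = All.map (λ cycle → oddCycle-meets-OCT G cycle (proj₁ minimal)) cyclesₘ
  in Z , minimal , (begin
    k               ≤⟨ m≤n+m∸n k 1 ⟩
    suc (k ∸ 1)     ≤⟨ large ⟩
    length members  ≤⟨ length≤∣transversal∣ members Z⊆∁core disjoint Z-meets ⟩
    ∣ Z ∣           ∎)
  where
  open ≤-Reasoning
  ⊥-bounded : ∀ {C} → IsInducedOddCycle G C × cycleLength C ≤ d → ⊥ ⊂ C × ∣ C ─ ⊥ ∣ ≤ d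
  ⊥-bounded {C} (cycle , length≤d) = ⊥⊂ (oddCycle-nonempty G cycle) , ≤-trans (∣p─q∣≤∣p∣ C ⊥) length≤d
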